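{- For every integer $n \ge 1$, there exists a nonsingular $2^{n-1}\times 2^{n-1}$ matrix $A_n$ over the field $\mathbb{Z}_3$ of integers modulo $3$ such that: (i) $A_n$ is obtained from $W_n$ by replacing each entry equal to $w$ by some nonzero element of $\mathbb{Z}_3$ (different entries may receive different values) and leaving the zero entries as $0$; and (ii) $A_n^{ -1}$ can also be obtained from $W_n$ in this way, i.e. by replacing each entry equal to $w$ by some nonzero element of $\mathbb{Z}_3$ and leaving the zero entries as $0$.
   Context: The $n$-dimensional hypercube $Q_n$ has vertex set $\{0,1\}^n$, two vertices being adjacent iff they differ in exactly one coordinate. Let $E_n$ be the set of vectors in $\{0,1\}^n$ with an even number of coordinates equal to $1$, and $O_n$ the set of those with an odd number of $1$'s; each has $2^{n-1}$ elements. $W_n$ is the $2^{n-1}\times 2^{n-1}$ matrix whose rows are indexed by the elements of $E_n$ in lexicographic order and whose columns are indexed by the elements of $O_n$ in lexicographic order, with the entry in row $x$ and column $y$ equal to an indeterminate $w$ if $x$ and $y$ are adjacent in $Q_n$ and equal to $0$ otherwise. (Equivalently, $W_1=[w]$ and $W_{n+1}=\begin{bmatrix} W_n & wI_{2^{n-1}}\\ wI_{2^{n-1}} & W_n\end{bmatrix}$, where $I_k$ is the $k\times k$ identity matrix.) -}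

module Defs where

open import Data.Nat using (ℕ; zero; suc; _+_; _*_; _∸_; _^_; _<ᵇ_; _≡ᵇ_)
open import Data.Nat.DivMod using (_mod_)
open import Data.Fin using (Fin; toℕ) renaming (zero to fzero; suc to fsuc)
open import Data.Bool using (Bool; true; false; if_then_else_; _∧_)
open import Relation.Binary.PropositionalEquality using (_≡_; _≢_)

ℤ₃ : Set
ℤ₃ = Fin 3

0₃ : ℤ₃
0₃ = fzero

1₃ : ℤ₃
1₃ = fsuc fzero

_+₃_ : ℤ₃ → ℤ₃ → ℤ₃
a +₃ b = (toℕ a + toℕ b) mod 3

_*₃_ : ℤ₃ → ℤ₃ → ℤ₃
a *₃ b = (toℕ a * toℕ b) mod 3

Mat : ℕ → Set
Mat m = Fin m → Fin m → ℤ₃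

sum₃ : ∀ {m} → (Fin m → ℤ₃) → ℤ₃
sum₃ {zero}  f = 0₃
sum₃ {suc m} f = f fzero +₃ sum₃ (λ i → f (fsuc i))

_·_ : ∀ {m} → Mat m → Mat m → Mat m
(A · B) i j = sum₃ (λ k → A i k *₃ B k j)

idMat : ∀ {m} → Mat m
idMat i j with toℕ i ≡ᵇ toℕ j
... | true  = 1₃
... | false = 0₃

-- Support of W_{k+1} (size 2^k): wSupp k i j = true iff the (i,j) entry of
-- W_{k+1} (0-based row/column indices i, j) equals w.  This follows the
-- recursion  W_1 = [w],  W_{k+2} = [[W_{k+1}, wI],[wI, W_{k+1}]]
-- with blocks of size h = 2^k.
wSupp : ℕ → ℕ → ℕ → Bool
wSupp zero    i j = true   -- W_1 = [w] (only i = j = 0 occurs)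
wSupp (suc k) i j =
  if i <ᵇ h
    then (if j <ᵇ h then wSupp k i j else (j ∸ h) ≡ᵇ i)
    else (if j <ᵇ h then (i ∸ h) ≡ᵇ j else wSupp k (i ∸ h) (j ∸ h))
  where h = 2 ^ k

W : (n : ℕ) → Fin (2 ^ (n ∸ 1)) → Fin (2 ^ (n ∸ 1)) → Bool
W n i j = wSupp (n ∸ 1) (toℕ i) (toℕ j)

ObtainedFromW : (n : ℕ) → Mat (2 ^ (n ∸ 1)) → Set
ObtainedFromW n A = ∀ i j → (W n i j ≡ true → A i j ≢ 0₃) × (W n i j ≡ false → A i j ≡ 0₃)
  where open import Data.Product using (_×_)

-- Over ℤ₃ put A₁ = [1] and A_{k+1} = [[A_k, I], [σ_k I, -A_k]] with σ_{k+1} = 2σ_k.  The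
-- block product shows A_{k+1}² = diag(A_k² + σ_k I, A_k² + σ_k I), so by induction A_k² = σ_k I
-- with σ_k = ±1; hence A_k⁻¹ = σ_k A_k.  Both matrices have the support of W_k, since the
-- recursion defining A_k follows that of W_k block by block.
module Submission where

open import Defs
open import Data.Nat using (ℕ; _≤_; _∸_; _^_)
open import Data.Product using (Σ; _×_)
open import Relation.Binary.PropositionalEquality using (_≡_)

open import Data.Bool using (Bool; true; false; if_then_else_; T)
open import Data.Bool.Properties using (T-≡)
open import Data.Fin using (Fin; toℕ) renaming (zero to fzero; suc to fsuc)
open import Data.Fin.Properties using (all?; toℕ<n) renaming (_≟_ to _≟₃_)
open import Data.Nat using (zero; suc; _+_; _*_; _<_; _<ᵇ_; _≡ᵇ_; z<s; s<s; _<?_)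
open import Data.Nat.Properties
  using (<⇒<ᵇ; <ᵇ⇒<; ≡ᵇ⇒≡; m+n≮m; m+n∸m≡n; m+[n∸m]≡n; ≮⇒≥; ∸-monoˡ-<; +-identityʳ;
         <⇒≢; <-≤-trans; m≤m+n; suc-injective)
open import Data.Product using (_,_)
open import Function using (_∘_)
open import Function.Bundles using (Equivalence)
open import Relation.Binary.PropositionalEquality
  using (_≢_; refl; sym; trans; cong; cong₂; subst; ≢-sym; module ≡-Reasoning)
open ≡-Reasoning
open import Relation.Nullary using (yes; no; contradiction)
open import Relation.Nullary.Decidable using (from-yes)

2₃ : ℤ₃
2₃ = fsuc (fsuc fzero)

+₃-identityˡ : ∀ x → 0₃ +₃ x ≡ x
+₃-identityˡ = from-yes (all? λ x → 0₃ +₃ x ≟₃ x)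

+₃-identityʳ : ∀ x → x +₃ 0₃ ≡ x
+₃-identityʳ = from-yes (all? λ x → x +₃ 0₃ ≟₃ x)

+₃-assoc : ∀ x y z → (x +₃ y) +₃ z ≡ x +₃ (y +₃ z)
+₃-assoc = from-yes (all? λ x → all? λ y → all? λ z → (x +₃ y) +₃ z ≟₃ x +₃ (y +₃ z))

*₃-identityˡ : ∀ x → 1₃ *₃ x ≡ x
*₃-identityˡ = from-yes (all? λ x → 1₃ *₃ x ≟₃ x)

*₃-identityʳ : ∀ x → x *₃ 1₃ ≡ x
*₃-identityʳ = from-yes (all? λ x → x *₃ 1₃ ≟₃ x)

*₃-zeroʳ : ∀ x → x *₃ 0₃ ≡ 0₃
*₃-zeroʳ = from-yes (all? λ x → x *₃ 0₃ ≟₃ 0₃)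

*₃-comm : ∀ x y → x *₃ y ≡ y *₃ x
*₃-comm = from-yes (all? λ x → all? λ y → x *₃ y ≟₃ y *₃ x)

*₃-assoc : ∀ x y z → (x *₃ y) *₃ z ≡ x *₃ (y *₃ z)
*₃-assoc = from-yes (all? λ x → all? λ y → all? λ z → (x *₃ y) *₃ z ≟₃ x *₃ (y *₃ z))

x*yz≡y*xz : ∀ x y z → x *₃ (y *₃ z) ≡ y *₃ (x *₃ z)
x*yz≡y*xz = from-yes (all? λ x → all? λ y → all? λ z → x *₃ (y *₃ z) ≟₃ y *₃ (x *₃ z))

*₃-distribˡ-+₃ : ∀ x y z → x *₃ (y +₃ z) ≡ (x *₃ y) +₃ (x *₃ z)
*₃-distribˡ-+₃ = from-yes (all? λ x → all? λ y → all? λ z → x *₃ (y +₃ z) ≟₃ (x *₃ y) +₃ (x *₃ z))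

x+2x≡0 : ∀ x → x +₃ (2₃ *₃ x) ≡ 0₃
x+2x≡0 = from-yes (all? λ x → x +₃ (2₃ *₃ x) ≟₃ 0₃)

2*2x≡x : ∀ x → 2₃ *₃ (2₃ *₃ x) ≡ x
2*2x≡x = from-yes (all? λ x → 2₃ *₃ (2₃ *₃ x) ≟₃ x)

[x+x]²≡x² : ∀ x → (x +₃ x) *₃ (x +₃ x) ≡ x *₃ x
[x+x]²≡x² = from-yes (all? λ x → (x +₃ x) *₃ (x +₃ x) ≟₃ x *₃ x)

*₃-nonzero : ∀ {x y} → x ≢ 0₃ → y ≢ 0₃ → x *₃ y ≢ 0₃
*₃-nonzero {fzero}                    x≢0 _   = contradiction refl x≢0
*₃-nonzero {fsuc _} {fzero}           _   y≢0 = contradiction refl y≢0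
*₃-nonzero {fsuc fzero}        {fsuc fzero}        _ _ ()
*₃-nonzero {fsuc fzero}        {fsuc (fsuc fzero)} _ _ ()
*₃-nonzero {fsuc (fsuc fzero)} {fsuc fzero}        _ _ ()
*₃-nonzero {fsuc (fsuc fzero)} {fsuc (fsuc fzero)} _ _ ()

∑ : ℕ → (ℕ → ℤ₃) → ℤ₃
∑ zero    f = 0₃
∑ (suc m) f = f 0 +₃ ∑ m (f ∘ suc)

sum₃≡∑ : ∀ m (f : ℕ → ℤ₃) → sum₃ {m} (f ∘ toℕ) ≡ ∑ m f
sum₃≡∑ zero    f = refl
sum₃≡∑ (suc m) f = cong (f 0 +₃_) (sum₃≡∑ m (f ∘ suc))

∑-cong : ∀ m {f g} → (∀ {l} → l < m → f l ≡ g l) → ∑ m f ≡ ∑ m g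
∑-cong zero    f≡g = refl
∑-cong (suc m) f≡g = cong₂ _+₃_ (f≡g z<s) (∑-cong m (f≡g ∘ s<s))

∑-+ : ∀ m n f → ∑ (m + n) f ≡ ∑ m f +₃ ∑ n (λ l → f (m + l))
∑-+ zero    n f = sym (+₃-identityˡ _)
∑-+ (suc m) n f = trans (cong (f 0 +₃_) (∑-+ m n (f ∘ suc))) (sym (+₃-assoc (f 0) _ _))

∑-*ˡ : ∀ m c f → ∑ m (λ l → c *₃ f l) ≡ c *₃ ∑ m f
∑-*ˡ zero    c f = sym (*₃-zeroʳ c)
∑-*ˡ (suc m) c f = trans (cong ((c *₃ f 0) +₃_) (∑-*ˡ m c (f ∘ suc))) (sym (*₃-distribˡ-+₃ c _ _))

∑-zero : ∀ m {f} → (∀ l → f l ≡ 0₃) → ∑ m f ≡ 0₃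
∑-zero zero    f≡0 = refl
∑-zero (suc m) f≡0 = cong₂ _+₃_ (f≡0 0) (∑-zero m (f≡0 ∘ suc))

∑-δ : ∀ {m i} f → i < m → (∀ l → l ≢ i → f l ≡ 0₃) → ∑ m f ≡ f i
∑-δ {suc m} {zero}  f _ f≡0 =
  trans (cong (f 0 +₃_) (∑-zero m (λ l → f≡0 (suc l) λ ()))) (+₃-identityʳ (f 0))
∑-δ {suc m} {suc i} f (s<s i<m) f≡0 =
  trans (cong (_+₃ ∑ m (f ∘ suc)) (f≡0 0 λ ()))
        (trans (+₃-identityˡ _) (∑-δ (f ∘ suc) i<m (λ l l≢i → f≡0 (suc l) (l≢i ∘ suc-injective))))

-- Matrices are indexed by all of ℕ; only the entries below the relevant size matter.
Matrix : Set
Matrix = ℕ → ℕ → ℤ₃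

infixr 8 _∙_
infixl 7 _⊙⟨_⟩_
infixl 6 _⊕_
infix  4 _≈⟨_⟩_

_⊙⟨_⟩_ : Matrix → ℕ → Matrix → Matrix
(M ⊙⟨ m ⟩ N) i j = ∑ m λ l → M i l *₃ N l j

_⊕_ : Matrix → Matrix → Matrix
(M ⊕ N) i j = M i j +₃ N i j

_∙_ : ℤ₃ → Matrix → Matrix
(c ∙ M) i j = c *₃ M i j

scalar : ℤ₃ → Matrix
scalar c i j = if i ≡ᵇ j then c else 0₃

𝟙 𝟘 : Matrix
𝟙 = scalar 1₃
𝟘 _ _ = 0₃

_≈⟨_⟩_ : Matrix → ℕ → Matrix → Set
M ≈⟨ m ⟩ N = ∀ i j → i < m → j < m → M i j ≡ N i j

≈-trans : ∀ {m L M N} → L ≈⟨ m ⟩ M → M ≈⟨ m ⟩ N → L ≈⟨ m ⟩ N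
≈-trans L≈M M≈N i j i<m j<m = trans (L≈M i j i<m j<m) (M≈N i j i<m j<m)

≈-sym : ∀ {m M N} → M ≈⟨ m ⟩ N → N ≈⟨ m ⟩ M
≈-sym M≈N i j i<m j<m = sym (M≈N i j i<m j<m)

≡ᵇ-sym : ∀ i j → (i ≡ᵇ j) ≡ (j ≡ᵇ i)
≡ᵇ-sym zero    zero    = refl
≡ᵇ-sym zero    (suc j) = refl
≡ᵇ-sym (suc i) zero    = refl
≡ᵇ-sym (suc i) (suc j) = ≡ᵇ-sym i j

scalar-diag : ∀ c i → scalar c i i ≡ c
scalar-diag c zero    = refl
scalar-diag c (suc i) = scalar-diag c i

scalar-off : ∀ c {i j} → i ≢ j → scalar c i j ≡ 0₃
scalar-off c {i} {j} i≢j with i ≡ᵇ j in i≡ᵇj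
... | true  = contradiction (≡ᵇ⇒≡ i j (subst T (sym i≡ᵇj) _)) i≢j
... | false = refl

scalar-shift : ∀ c h i j → scalar c (h + i) (h + j) ≡ scalar c i j
scalar-shift c zero    i j = refl
scalar-shift c (suc h) i j = scalar-shift c h i j

scalar-+ : ∀ c d i j → scalar c i j +₃ scalar d i j ≡ scalar (c +₃ d) i j
scalar-+ c d i j with i ≡ᵇ j
... | true  = refl
... | false = refl

*-scalar : ∀ c d i j → c *₃ scalar d i j ≡ scalar (c *₃ d) i j
*-scalar c d i j with i ≡ᵇ j
... | true  = refl
... | false = *₃-zeroʳ c

scalar-⊙ : ∀ {m} c M {i} j → i < m → (scalar c ⊙⟨ m ⟩ M) i j ≡ c *₃ M i j
scalar-⊙ c M {i} j i<m =
  trans (∑-δ _ i<m (λ l l≢i → cong (_*₃ M l j) (scalar-off c (≢-sym l≢i))))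
        (cong (_*₃ M i j) (scalar-diag c i))

⊙-scalar : ∀ {m} c M i {j} → j < m → (M ⊙⟨ m ⟩ scalar c) i j ≡ M i j *₃ c
⊙-scalar c M i {j} j<m =
  trans (∑-δ _ j<m (λ l l≢j → trans (cong (M i l *₃_) (scalar-off c l≢j)) (*₃-zeroʳ (M i l))))
        (cong (M i j *₃_) (scalar-diag c j))

∙-⊙ : ∀ m c M N i j → (c ∙ M ⊙⟨ m ⟩ N) i j ≡ c *₃ (M ⊙⟨ m ⟩ N) i j
∙-⊙ m c M N i j = trans (∑-cong m λ {l} _ → *₃-assoc c (M i l) (N l j)) (∑-*ˡ m c _)

⊙-∙ : ∀ m c M N i j → (M ⊙⟨ m ⟩ c ∙ N) i j ≡ c *₃ (M ⊙⟨ m ⟩ N) i j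
⊙-∙ m c M N i j = trans (∑-cong m λ {l} _ → x*yz≡y*xz (M i l) c (N l j)) (∑-*ˡ m c _)

<ᵇ-true : ∀ {i h} → i < h → (i <ᵇ h) ≡ true
<ᵇ-true = Equivalence.to T-≡ ∘ <⇒<ᵇ

+<ᵇ-false : ∀ h l → (h + l <ᵇ h) ≡ false
+<ᵇ-false h l with h + l <ᵇ h in h+l<ᵇh
... | false = refl
... | true  = contradiction (<ᵇ⇒< (h + l) h (subst T (sym h+l<ᵇh) _)) (m+n≮m h l)

-- block h P Q R S is [[P, Q], [R, S]] with an h × h upper-left block.  Opaque, so that
-- unification can read off its arguments.
opaque
  block : {X : Set} → ℕ → (P Q R S : ℕ → ℕ → X) → ℕ → ℕ → X
  block h P Q R S i j =
    if i <ᵇ h then (if j <ᵇ h then P i j else Q i (j ∸ h))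
              else (if j <ᵇ h then R (i ∸ h) j else S (i ∸ h) (j ∸ h))

opaque
  unfolding block

  wSupp-block : ∀ k i j → wSupp (suc k) i j ≡ block (2 ^ k) (wSupp k) (λ i j → j ≡ᵇ i) _≡ᵇ_ (wSupp k) i j
  wSupp-block k i j = refl

  block-pointwise : ∀ {X Y : Set} (_∼_ : X → Y → Set) h {P Q R S P′ Q′ R′ S′} →
    (∀ i j → P i j ∼ P′ i j) → (∀ i j → Q i j ∼ Q′ i j) →
    (∀ i j → R i j ∼ R′ i j) → (∀ i j → S i j ∼ S′ i j) →
    ∀ i j → block h P Q R S i j ∼ block h P′ Q′ R′ S′ i j
  block-pointwise _∼_ h P∼ Q∼ R∼ S∼ i j with i <ᵇ h | j <ᵇ h
  ... | true  | true  = P∼ i j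
  ... | true  | false = Q∼ i (j ∸ h)
  ... | false | true  = R∼ (i ∸ h) j
  ... | false | false = S∼ (i ∸ h) (j ∸ h)

  block-↖ : ∀ {X h} {P Q R S : ℕ → ℕ → X} {i j} → i < h → j < h → block h P Q R S i j ≡ P i j
  block-↖ i<h j<h rewrite <ᵇ-true i<h | <ᵇ-true j<h = refl

  block-↗ : ∀ {X h} {P Q R S : ℕ → ℕ → X} {i j} → i < h → block h P Q R S i (h + j) ≡ Q i j
  block-↗ {h = h} {j = j} i<h rewrite <ᵇ-true i<h | +<ᵇ-false h j | m+n∸m≡n h j = refl

  block-↙ : ∀ {X h} {P Q R S : ℕ → ℕ → X} {i j} → j < h → block h P Q R S (h + i) j ≡ R i j
  block-↙ {h = h} {i = i} j<h rewrite <ᵇ-true j<h | +<ᵇ-false h i | m+n∸m≡n h i = refl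

  block-↘ : ∀ {X h} {P Q R S : ℕ → ℕ → X} {i j} → block h P Q R S (h + i) (h + j) ≡ S i j
  block-↘ {h = h} {i = i} {j} rewrite +<ᵇ-false h i | +<ᵇ-false h j | m+n∸m≡n h i | m+n∸m≡n h j = refl

data Half (h : ℕ) : ℕ → Set where
  lower : ∀ {i} → i < h → Half h i
  upper : ∀ {i} → i < h → Half h (h + i)

half : ∀ h {i} → i < 2 * h → Half h i
half h {i} i<2h with i <? h
... | yes i<h = lower i<h
... | no  i≮h = subst (Half h) (m+[n∸m]≡n (≮⇒≥ i≮h))
  (upper (subst (i ∸ h <_) (trans (m+n∸m≡n h (h + 0)) (+-identityʳ h)) (∸-monoˡ-< i<2h (≮⇒≥ i≮h))))

by-halves : ∀ {h M N} → (∀ {i j} → Half h i → Half h j → M i j ≡ N i j) → M ≈⟨ 2 * h ⟩ N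
by-halves {h} M≡N i j i<2h j<2h = M≡N (half h i<2h) (half h j<2h)

⊙-halves : ∀ h M N M₁ N₁ M₂ N₂ {i j i′ j′} →
  (∀ {l} → l < h → M i l ≡ M₁ i′ l) → (∀ {l} → l < h → N l j ≡ N₁ l j′) →
  (∀ {l} → l < h → M i (h + l) ≡ M₂ i′ l) → (∀ {l} → l < h → N (h + l) j ≡ N₂ l j′) →
  (M ⊙⟨ 2 * h ⟩ N) i j ≡ (M₁ ⊙⟨ h ⟩ N₁ ⊕ M₂ ⊙⟨ h ⟩ N₂) i′ j′
⊙-halves h M N M₁ N₁ M₂ N₂ {i} {j} M≡M₁ N≡N₁ M≡M₂ N≡N₂ =
  trans (∑-+ h (h + 0) _)
        (cong₂ _+₃_ (∑-cong h λ l<h → cong₂ _*₃_ (M≡M₁ l<h) (N≡N₁ l<h))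
                    (trans (cong (λ n → ∑ n λ l → M i (h + l) *₃ N (h + l) j) (+-identityʳ h))
                           (∑-cong h λ l<h → cong₂ _*₃_ (M≡M₂ l<h) (N≡N₂ l<h))))

module _ {h : ℕ} {P Q R S P′ Q′ R′ S′ : Matrix} where

  private
    B B′ : Matrix
    B  = block h P Q R S
    B′ = block h P′ Q′ R′ S′

  block-⊙ : block h P Q R S ⊙⟨ 2 * h ⟩ block h P′ Q′ R′ S′
            ≈⟨ 2 * h ⟩ block h (P ⊙⟨ h ⟩ P′ ⊕ Q ⊙⟨ h ⟩ R′) (P ⊙⟨ h ⟩ Q′ ⊕ Q ⊙⟨ h ⟩ S′)
                               (R ⊙⟨ h ⟩ P′ ⊕ S ⊙⟨ h ⟩ R′) (R ⊙⟨ h ⟩ Q′ ⊕ S ⊙⟨ h ⟩ S′)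
  block-⊙ = by-halves λ where
    (lower i<h) (lower j<h) → trans
      (⊙-halves h B B′ P P′ Q R′ (block-↖ i<h) (λ l<h → block-↖ l<h j<h) (λ _ → block-↗ i<h) (λ _ → block-↙ j<h))
      (sym (block-↖ i<h j<h))
    (lower i<h) (upper _) → trans
      (⊙-halves h B B′ P Q′ Q S′ (block-↖ i<h) (λ l<h → block-↗ l<h) (λ _ → block-↗ i<h) (λ _ → block-↘))
      (sym (block-↗ i<h))
    (upper _) (lower j<h) → trans
      (⊙-halves h B B′ R P′ S R′ block-↙ (λ l<h → block-↖ l<h j<h) (λ _ → block-↘) (λ _ → block-↙ j<h))
      (sym (block-↙ j<h))
    (upper _) (upper _) → trans
      (⊙-halves h B B′ R Q′ S S′ block-↙ block-↗ (λ _ → block-↘) (λ _ → block-↘))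
      (sym block-↘)

  block-cong : P ≈⟨ h ⟩ P′ → Q ≈⟨ h ⟩ Q′ → R ≈⟨ h ⟩ R′ → S ≈⟨ h ⟩ S′ →
               block h P Q R S ≈⟨ 2 * h ⟩ block h P′ Q′ R′ S′
  block-cong P≈ Q≈ R≈ S≈ = by-halves λ where
    (lower i<h) (lower j<h) → trans (block-↖ i<h j<h) (trans (P≈ _ _ i<h j<h) (sym (block-↖ i<h j<h)))
    (lower i<h) (upper j<h) → trans (block-↗ i<h) (trans (Q≈ _ _ i<h j<h) (sym (block-↗ i<h)))
    (upper i<h) (lower j<h) → trans (block-↙ j<h) (trans (R≈ _ _ i<h j<h) (sym (block-↙ j<h)))
    (upper i<h) (upper j<h) → trans block-↘ (trans (S≈ _ _ i<h j<h) (sym block-↘))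

scalar-block : ∀ c h → scalar c ≈⟨ 2 * h ⟩ block h (scalar c) 𝟘 𝟘 (scalar c)
scalar-block c h = by-halves λ where
  (lower i<h) (lower j<h) → sym (block-↖ i<h j<h)
  (lower i<h) (upper _)   → trans (scalar-off c (<⇒≢ (<-≤-trans i<h (m≤m+n h _)))) (sym (block-↗ i<h))
  (upper _)   (lower j<h) → trans (scalar-off c (≢-sym (<⇒≢ (<-≤-trans j<h (m≤m+n h _))))) (sym (block-↙ j<h))
  (upper {i} _) (upper {j} _) → trans (scalar-shift c h i j) (sym block-↘)

sgn : ℕ → ℤ₃
sgn zero    = 1₃
sgn (suc k) = sgn k +₃ sgn k

sgn²≡1 : ∀ k → sgn k *₃ sgn k ≡ 1₃
sgn²≡1 zero    = refl
sgn²≡1 (suc k) = trans ([x+x]²≡x² (sgn k)) (sgn²≡1 k)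

sgn≢0 : ∀ k → sgn k ≢ 0₃
sgn≢0 k sgn≡0 = contradiction (trans (cong (λ x → x *₃ x) (sym sgn≡0)) (sgn²≡1 k)) λ ()

-- A k is A_{k+1} above, of size 2 ^ k; multiplication by 2₃ is negation.
A : ℕ → Matrix
A zero    _ _ = 1₃
A (suc k) = block (2 ^ k) (A k) 𝟙 (scalar (sgn k)) (2₃ ∙ A k)

A²≈sgn : ∀ k → A k ⊙⟨ 2 ^ k ⟩ A k ≈⟨ 2 ^ k ⟩ scalar (sgn k)
A²≈sgn zero    _ _ z<s z<s = refl
A²≈sgn (suc k) = ≈-trans block-⊙ (≈-trans (block-cong ↖ ↗ ↙ ↘) (≈-sym (scalar-block (sgn (suc k)) h)))
  where
  h = 2 ^ k
  s = sgn k

  ↖ : A k ⊙⟨ h ⟩ A k ⊕ 𝟙 ⊙⟨ h ⟩ scalar s ≈⟨ h ⟩ scalar (sgn (suc k))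
  ↖ i j i<h j<h =
    trans (cong₂ _+₃_ (A²≈sgn k i j i<h j<h) (trans (scalar-⊙ 1₃ (scalar s) j i<h) (*₃-identityˡ (scalar s i j))))
          (scalar-+ s s i j)

  ↗ : A k ⊙⟨ h ⟩ 𝟙 ⊕ 𝟙 ⊙⟨ h ⟩ (2₃ ∙ A k) ≈⟨ h ⟩ 𝟘
  ↗ i j i<h j<h =
    trans (cong₂ _+₃_ (trans (⊙-scalar 1₃ (A k) i j<h) (*₃-identityʳ (A k i j)))
                      (trans (scalar-⊙ 1₃ (2₃ ∙ A k) j i<h) (*₃-identityˡ (2₃ *₃ A k i j))))
          (x+2x≡0 (A k i j))

  ↙ : scalar s ⊙⟨ h ⟩ A k ⊕ (2₃ ∙ A k) ⊙⟨ h ⟩ scalar s ≈⟨ h ⟩ 𝟘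
  ↙ i j i<h j<h = begin
    (scalar s ⊙⟨ h ⟩ A k) i j +₃ ((2₃ ∙ A k) ⊙⟨ h ⟩ scalar s) i j
      ≡⟨ cong₂ _+₃_ (scalar-⊙ s (A k) j i<h) (trans (⊙-scalar s (2₃ ∙ A k) i j<h) (*₃-comm (2₃ *₃ A k i j) s)) ⟩
    (s *₃ A k i j) +₃ (s *₃ (2₃ *₃ A k i j))
      ≡⟨ sym (*₃-distribˡ-+₃ s (A k i j) (2₃ *₃ A k i j)) ⟩
    s *₃ (A k i j +₃ (2₃ *₃ A k i j))
      ≡⟨ cong (s *₃_) (x+2x≡0 (A k i j)) ⟩
    s *₃ 0₃
      ≡⟨ *₃-zeroʳ s ⟩
    0₃ ∎

  ↘ : scalar s ⊙⟨ h ⟩ 𝟙 ⊕ (2₃ ∙ A k) ⊙⟨ h ⟩ (2₃ ∙ A k) ≈⟨ h ⟩ scalar (sgn (suc k))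
  ↘ i j i<h j<h = begin
    (scalar s ⊙⟨ h ⟩ 𝟙) i j +₃ ((2₃ ∙ A k) ⊙⟨ h ⟩ (2₃ ∙ A k)) i j
      ≡⟨ cong₂ _+₃_ (trans (⊙-scalar 1₃ (scalar s) i j<h) (*₃-identityʳ (scalar s i j)))
                    (trans (∙-⊙ h 2₃ (A k) (2₃ ∙ A k) i j) (cong (2₃ *₃_) (⊙-∙ h 2₃ (A k) (A k) i j))) ⟩
    scalar s i j +₃ (2₃ *₃ (2₃ *₃ (A k ⊙⟨ h ⟩ A k) i j))
      ≡⟨ cong (scalar s i j +₃_) (trans (2*2x≡x ((A k ⊙⟨ h ⟩ A k) i j)) (A²≈sgn k i j i<h j<h)) ⟩
    scalar s i j +₃ scalar s i j
      ≡⟨ scalar-+ s s i j ⟩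
    scalar (sgn (suc k)) i j ∎

A⊙sgnA≈𝟙 : ∀ k → A k ⊙⟨ 2 ^ k ⟩ sgn k ∙ A k ≈⟨ 2 ^ k ⟩ 𝟙
A⊙sgnA≈𝟙 k i j i< j< = begin
  (A k ⊙⟨ 2 ^ k ⟩ sgn k ∙ A k) i j      ≡⟨ ⊙-∙ (2 ^ k) (sgn k) (A k) (A k) i j ⟩
  sgn k *₃ (A k ⊙⟨ 2 ^ k ⟩ A k) i j     ≡⟨ cong (sgn k *₃_) (A²≈sgn k i j i< j<) ⟩
  sgn k *₃ scalar (sgn k) i j           ≡⟨ *-scalar (sgn k) (sgn k) i j ⟩
  scalar (sgn k *₃ sgn k) i j           ≡⟨ cong (λ c → scalar c i j) (sgn²≡1 k) ⟩
  𝟙 i j                                 ∎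

sgnA⊙A≈𝟙 : ∀ k → sgn k ∙ A k ⊙⟨ 2 ^ k ⟩ A k ≈⟨ 2 ^ k ⟩ 𝟙
sgnA⊙A≈𝟙 k i j i< j< =
  trans (∙-⊙ (2 ^ k) (sgn k) (A k) (A k) i j)
        (trans (sym (⊙-∙ (2 ^ k) (sgn k) (A k) (A k) i j)) (A⊙sgnA≈𝟙 k i j i< j<))

-- ObtainedFromW n M unfolds to ∀ i j → Supports (W n i j) (M i j).
Supports : Bool → ℤ₃ → Set
Supports b x = (b ≡ true → x ≢ 0₃) × (b ≡ false → x ≡ 0₃)

scalar-supports : ∀ {c} → c ≢ 0₃ → ∀ i j → Supports (i ≡ᵇ j) (scalar c i j)
scalar-supports c≢0 i j with i ≡ᵇ j
... | true  = (λ _ → c≢0) , λ ()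
... | false = (λ ()) , λ _ → refl

*-supports : ∀ {c b x} → c ≢ 0₃ → Supports b x → Supports b (c *₃ x)
*-supports {c} c≢0 (≢0 , ≡0) = (λ b≡true → *₃-nonzero c≢0 (≢0 b≡true)) ,
                               (λ b≡false → trans (cong (c *₃_) (≡0 b≡false)) (*₃-zeroʳ c))

A-supports : ∀ k i j → Supports (wSupp k i j) (A k i j)
A-supports zero    i j = (λ _ ()) , λ ()
A-supports (suc k) i j = subst (λ b → Supports b (A (suc k) i j)) (sym (wSupp-block k i j))
  (block-pointwise Supports (2 ^ k) (A-supports k)
     (λ i j → subst (λ b → Supports b (𝟙 i j)) (≡ᵇ-sym i j) (scalar-supports (λ ()) i j))
     (scalar-supports (sgn≢0 k))
     (λ i j → *-supports {2₃} (λ ()) (A-supports k i j)) i j)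

restrict : ∀ m → Matrix → Mat m
restrict m M i j = M (toℕ i) (toℕ j)

restrict-· : ∀ m M N (i j : Fin m) → (restrict m M · restrict m N) i j ≡ (M ⊙⟨ m ⟩ N) (toℕ i) (toℕ j)
restrict-· m M N i j = sum₃≡∑ m (λ l → M (toℕ i) l *₃ N l (toℕ j))

idMat≡𝟙 : ∀ {m} (i j : Fin m) → idMat i j ≡ 𝟙 (toℕ i) (toℕ j)
idMat≡𝟙 i j with toℕ i ≡ᵇ toℕ j
... | true  = refl
... | false = refl

restrict-inverse : ∀ m M N → M ⊙⟨ m ⟩ N ≈⟨ m ⟩ 𝟙 → ∀ i j → (restrict m M · restrict m N) i j ≡ idMat i j
restrict-inverse m M N MN≈𝟙 i j =
  trans (restrict-· m M N i j) (trans (MN≈𝟙 _ _ (toℕ<n i) (toℕ<n j)) (sym (idMat≡𝟙 i j)))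

lemma1 : (n : ℕ) → 1 ≤ n →
    Σ (Mat (2 ^ (n ∸ 1))) λ A → Σ (Mat (2 ^ (n ∸ 1))) λ A⁻¹ →
      (∀ i j → (A · A⁻¹) i j ≡ idMat i j) × (∀ i j → (A⁻¹ · A) i j ≡ idMat i j) ×
      ObtainedFromW n A × ObtainedFromW n A⁻¹
lemma1 (suc k) _ =
  restrict m (A k) , restrict m (sgn k ∙ A k) ,
  restrict-inverse m (A k) (sgn k ∙ A k) (A⊙sgnA≈𝟙 k) ,
  restrict-inverse m (sgn k ∙ A k) (A k) (sgnA⊙A≈𝟙 k) ,
  (λ i j → A-supports k (toℕ i) (toℕ j)) ,
  (λ i j → *-supports (sgn≢0 k) (A-supports k (toℕ i) (toℕ j)))
  where
  m = 2 ^ k
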